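{- Let $D$ be a multipartite tournament and let $X$ be a partite set of $D$ that is not $\{1,2\}$-competing. If $u,v\in X$ are adjacent in $C_{1,2}(D)$ and are not true twins in $C_{1,2}(D)$, then every vertex of $D$ that is adjacent in $C_{1,2}(D)$ to neither $u$ nor $v$ belongs to $X$.
   Context: All graphs and digraphs are finite and simple. For a digraph $D$, $d_D(x,y)$ is the length of a shortest directed path from $x$ to $y$. The $(1,2)$-step competition graph $C_{1,2}(D)$ is the graph on $V(D)$ in which distinct $u,v$ are adjacent iff there is a vertex $w\notin\{u,v\}$ with either $d_{D-v}(u,w)\le 1$ and $d_{D-u}(v,w)\le 2$, or $d_{D-u}(v,w)\le 1$ and $d_{D-v}(u,w)\le 2$. A multipartite tournament is an orientation of a complete $k$-partite graph for some $k\ge3$ (with nonempty partite sets). A set of vertices is $\{1,2\}$-competing if it is a clique in $C_{1,2}(D)$. Two vertices of a graph are true twins if they have the same closed neighborhood. -}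

module Defs where

open import Data.Nat using (ℕ; _≤_)
open import Data.Fin using (Fin)
open import Data.Product using (Σ; ∃; _×_; _,_)
open import Data.Sum using (_⊎_)
open import Data.Empty using (⊥)
open import Relation.Nullary using (¬_)
open import Relation.Binary.PropositionalEquality using (_≡_; _≢_)
open import Function.Bundles using (_⇔_)

-- A (simple) digraph on vertex set Fin n: an irreflexive arc relation.
-- (Simplicity of a digraph: no loops; at most one arc per ordered pair is
--  automatic for a relation.)
record Digraph (n : ℕ) : Set₁ where
  field
    Arc    : Fin n → Fin n → Set
    irrefl : ∀ x → ¬ Arc x x

open Digraph public

record IsMultipartiteTournament {n : ℕ} (D : Digraph n) (k : ℕ) (part : Fin n → Fin k) : Set where
  field
    three≤k    : 3 ≤ k
    nonempty   : ∀ (i : Fin k) → ∃ λ x → part x ≡ i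
    noArcInside : ∀ x y → part x ≡ part y → ¬ Arc D x y
    oneArc     : ∀ x y → part x ≢ part y → Arc D x y ⊎ Arc D y x
    notBoth    : ∀ x y → ¬ (Arc D x y × Arc D y x)

-- d_{D-r}(x,y) ≤ 1 : x, y are vertices of D - r and x = y or x → y.
Dist≤1 : ∀ {n} → Digraph n → (r x y : Fin n) → Set
Dist≤1 D r x y = x ≢ r × y ≢ r × (x ≡ y ⊎ Arc D x y)

-- d_{D-r}(x,y) ≤ 2 : x, y are vertices of D - r and x = y, or x → y, or
-- x → z → y for some vertex z of D - r.
Dist≤2 : ∀ {n} → Digraph n → (r x y : Fin n) → Set
Dist≤2 D r x y = x ≢ r × y ≢ r ×
  (x ≡ y ⊎ Arc D x y ⊎ (∃ λ z → z ≢ r × Arc D x z × Arc D z y))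

C12 : ∀ {n} → Digraph n → Fin n → Fin n → Set
C12 D u v = u ≢ v × ∃ λ w → w ≢ u × w ≢ v ×
  ((Dist≤1 D v u w × Dist≤2 D u v w) ⊎ (Dist≤1 D u v w × Dist≤2 D v u w))

Competing12 : ∀ {n} → Digraph n → (Fin n → Set) → Set
Competing12 D S = ∀ x y → S x → S y → x ≢ y → C12 D x y

TrueTwins : ∀ {n} → Digraph n → Fin n → Fin n → Set
TrueTwins D u v = ∀ z → ((z ≡ u ⊎ C12 D u z) ⇔ (z ≡ v ⊎ C12 D v z))

{-# OPTIONS --safe #-}
module Submission where

-- Suppose z ∉ X. If u had an out-neighbour w ≠ z, then, since u and z do not
-- (1,2)-compete, every other vertex of X would beat z; were z also within two
-- steps of u, all of X would share the prey z and X would be {1,2}-competing.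
-- Playing this against the competition witness of u and v forces u → z and
-- v → z with z the only out-neighbour of either. Then every (1,2)-competitor
-- of u other than v also competes with v, and vice versa: u, v are true twins.

open import Defs
open import Data.Nat using (ℕ)
open import Data.Fin using (Fin)
open import Data.Fin.Properties using (_≟_)
open import Data.Product using (∃; _×_; _,_; proj₁)
open import Data.Sum using (_⊎_; inj₁; inj₂)
open import Data.Empty using (⊥; ⊥-elim)
open import Relation.Nullary using (¬_; yes; no)
open import Relation.Binary.PropositionalEquality using (_≡_; _≢_; refl; sym; trans; ≢-sym)
open import Function.Bundles using (mk⇔)

module Competition {n : ℕ} (D : Digraph n) where

  Reach≤2 : (r x y : Fin n) → Set
  Reach≤2 r x y = x ≡ y ⊎ Arc D x y ⊎ (∃ λ m → m ≢ r × Arc D x m × Arc D m y)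

  CommonPrey : (u v w : Fin n) → Set
  CommonPrey u v w = w ≢ u × w ≢ v × Arc D u w × Reach≤2 u v w

  ClosedNbhd : Fin n → Fin n → Set
  ClosedNbhd u t = t ≡ u ⊎ C12 D u t

  prey⇒C12 : ∀ {u v w} → u ≢ v → CommonPrey u v w → C12 D u v
  prey⇒C12 u≢v (w≢u , w≢v , u→w , v⇝w) =
    u≢v , _ , w≢u , w≢v , inj₁ ((u≢v , w≢v , inj₂ u→w) , (≢-sym u≢v , w≢u , v⇝w))

  C12⇒prey : ∀ {u v} → C12 D u v → ∃ λ w → CommonPrey u v w ⊎ CommonPrey v u w
  C12⇒prey (_ , w , w≢u , _   , inj₁ ((_ , _ , inj₁ u≡w) , _)) = ⊥-elim (w≢u (sym u≡w))
  C12⇒prey (_ , w , w≢u , w≢v , inj₁ ((_ , _ , inj₂ u→w) , (_ , _ , v⇝w))) =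
    w , inj₁ (w≢u , w≢v , u→w , v⇝w)
  C12⇒prey (_ , w , _   , w≢v , inj₂ ((_ , _ , inj₁ v≡w) , _)) = ⊥-elim (w≢v (sym v≡w))
  C12⇒prey (_ , w , w≢u , w≢v , inj₂ ((_ , _ , inj₂ v→w) , (_ , _ , u⇝w))) =
    w , inj₂ (w≢v , w≢u , v→w , u⇝w)

  C12-sym : ∀ {u v} → C12 D u v → C12 D v u
  C12-sym (u≢v , w , w≢u , w≢v , inj₁ p) = ≢-sym u≢v , w , w≢v , w≢u , inj₂ p
  C12-sym (u≢v , w , w≢u , w≢v , inj₂ p) = ≢-sym u≢v , w , w≢v , w≢u , inj₁ p

module PartiteSet {n k : ℕ} {D : Digraph n} {part : Fin n → Fin k}
                  (mt : IsMultipartiteTournament D k part) (i : Fin k) where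
  open IsMultipartiteTournament mt
  open Competition D

  X : Fin n → Set
  X x = part x ≡ i

  Within2 : Fin n → Fin n → Set
  Within2 x z = Arc D x z ⊎ ∃ λ m → Arc D x m × Arc D m z

  OutNbrs⊆ : Fin n → Fin n → Set
  OutNbrs⊆ u z = ∀ w → Arc D u w → w ≡ z

  arc⇒≢ : ∀ {x y} → Arc D x y → x ≢ y
  arc⇒≢ {x} x→y refl = irrefl D x x→y

  arc-asym : ∀ {x y} → Arc D x y → ¬ Arc D y x
  arc-asym x→y y→x = notBoth _ _ (x→y , y→x)

  arc-leaves-X : ∀ {x y} → X x → Arc D x y → ¬ X y
  arc-leaves-X {x} {y} x∈X x→y y∈X = noArcInside x y (trans x∈X (sym y∈X)) x→y

  ∈X∉X⇒≢ : ∀ {x y} → X x → ¬ X y → x ≢ y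
  ∈X∉X⇒≢ x∈X y∉X refl = y∉X x∈X

  arc-between : ∀ {x y} → X x → ¬ X y → Arc D x y ⊎ Arc D y x
  arc-between {x} {y} x∈X y∉X = oneArc x y (λ eq → y∉X (trans (sym eq) x∈X))

  within2⇒reach≤2 : ∀ {r x z} → X r → X x → Within2 x z → Reach≤2 r x z
  within2⇒reach≤2 r∈X x∈X (inj₁ x→z) = inj₂ (inj₁ x→z)
  within2⇒reach≤2 r∈X x∈X (inj₂ (m , x→m , m→z)) =
    inj₂ (inj₂ (m , (λ { refl → arc-leaves-X x∈X x→m r∈X }) , x→m , m→z))

  -- If z → x, the arc between x and w yields a common prey of u and z:
  -- w (via z → x → w) or x (via u → w → x).
  others-beat : ∀ {u z w} → ¬ C12 D u z → X u → ¬ X z → Arc D u w → w ≢ z →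
                ∀ x → X x → x ≢ u → Arc D x z
  others-beat {w = w} u≁z u∈X z∉X u→w w≢z x x∈X x≢u with arc-between x∈X z∉X
  ... | inj₁ x→z = x→z
  ... | inj₂ z→x with arc-between x∈X (arc-leaves-X u∈X u→w)
  ...   | inj₁ x→w = ⊥-elim (u≁z (prey⇒C12 (∈X∉X⇒≢ u∈X z∉X)
            (≢-sym (arc⇒≢ u→w) , w≢z , u→w , inj₂ (inj₂ (x , x≢u , z→x , x→w)))))
  ...   | inj₂ w→x = ⊥-elim (u≁z (C12-sym (prey⇒C12 (≢-sym (∈X∉X⇒≢ u∈X z∉X))
            (∈X∉X⇒≢ x∈X z∉X , x≢u , z→x , inj₂ (inj₂ (w , w≢z , u→w , w→x))))))

  beat⇒C12 : ∀ {x y z} → X x → X y → ¬ X z → x ≢ y → Arc D x z → Within2 y z → C12 D x y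
  beat⇒C12 x∈X y∈X z∉X x≢y x→z y⇝z =
    prey⇒C12 x≢y (≢-sym (arc⇒≢ x→z) , ≢-sym (∈X∉X⇒≢ y∈X z∉X) , x→z , within2⇒reach≤2 x∈X y∈X y⇝z)

  all-beat⇒competing : ∀ {u z} → X u → ¬ X z → (∀ x → X x → x ≢ u → Arc D x z) → Within2 u z →
                       Competing12 D X
  all-beat⇒competing {u} {z} u∈X z∉X beat u⇝z = competing
    where
      within2 : ∀ {y} → X y → Within2 y z
      within2 {y} y∈X with y ≟ u
      ... | yes refl = u⇝z
      ... | no y≢u = inj₁ (beat y y∈X y≢u)
      competing : Competing12 D X
      competing x y x∈X y∈X x≢y with x ≟ u
      ... | yes refl = C12-sym (beat⇒C12 y∈X x∈X z∉X (≢-sym x≢y) (beat y y∈X (≢-sym x≢y)) u⇝z)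
      ... | no x≢u = beat⇒C12 x∈X y∈X z∉X x≢y (beat x x∈X x≢u) (within2 y∈X)

  escape⇒competing : ∀ {u z w} → ¬ C12 D u z → X u → ¬ X z → Arc D u w → w ≢ z → Within2 u z →
                     Competing12 D X
  escape⇒competing u≁z u∈X z∉X u→w w≢z =
    all-beat⇒competing u∈X z∉X (others-beat u≁z u∈X z∉X u→w w≢z)

  sole-out-neighbour : ∀ {u z} → ¬ Competing12 D X → ¬ C12 D u z → X u → ¬ X z → Arc D u z →
                       OutNbrs⊆ u z
  sole-out-neighbour {z = z} ¬competing u≁z u∈X z∉X u→z w u→w with w ≟ z
  ... | yes w≡z = w≡z
  ... | no w≢z = ⊥-elim (¬competing (escape⇒competing u≁z u∈X z∉X u→w w≢z (inj₁ u→z)))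

  beaten⇒out-nbrs⊆ : ∀ {u v z} → ¬ C12 D v z → X v → ¬ X z → X u → u ≢ v → ¬ Arc D u z →
                     OutNbrs⊆ v z
  beaten⇒out-nbrs⊆ {u} {z = z} v≁z v∈X z∉X u∈X u≢v ¬u→z w v→w with w ≟ z
  ... | yes w≡z = w≡z
  ... | no w≢z = ⊥-elim (¬u→z (others-beat v≁z v∈X z∉X v→w w≢z u u∈X u≢v))

  -- If z → u then every out-neighbour of v is z, and each shape of the competition
  -- witness of u and v yields a competition of u or v with z, or makes X competing.
  not-beaten : ∀ {u v z} → ¬ Competing12 D X → ¬ X z → X u → X v → C12 D u v →
               ¬ C12 D u z → ¬ C12 D v z → ¬ Arc D z u
  not-beaten {u} {v} {z} ¬competing z∉X u∈X v∈X u~v u≁z v≁z z→u = refute (C12⇒prey u~v)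
    where
      v-out : OutNbrs⊆ v z
      v-out = beaten⇒out-nbrs⊆ v≁z v∈X z∉X u∈X (proj₁ u~v) (arc-asym z→u)
      u≢z : u ≢ z
      u≢z = ∈X∉X⇒≢ u∈X z∉X
      refute : (∃ λ w → CommonPrey u v w ⊎ CommonPrey v u w) → ⊥
      refute (w , inj₁ (_ , w≢v , _ , inj₁ v≡w)) = w≢v (sym v≡w)
      refute (w , inj₁ (_ , _ , u→w , inj₂ (inj₁ v→w))) with v-out w v→w
      ... | refl = arc-asym z→u u→w
      refute (w , inj₁ (w≢u , _ , u→w , inj₂ (inj₂ (m , _ , v→m , m→w)))) with v-out m v→m
      ... | refl = u≁z (prey⇒C12 u≢z
                     (w≢u , (λ { refl → arc-asym z→u u→w }) , u→w , inj₂ (inj₁ m→w)))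
      refute (w , inj₂ (_ , _ , v→w , inj₁ u≡w)) with v-out w v→w
      ... | refl = u≢z u≡w
      refute (w , inj₂ (_ , _ , v→w , inj₂ (inj₁ u→w))) with v-out w v→w
      ... | refl = arc-asym z→u u→w
      refute (w , inj₂ (_ , _ , v→w , inj₂ (inj₂ (m , _ , u→m , m→w)))) with v-out w v→w
      ... | refl = ¬competing
                     (escape⇒competing u≁z u∈X z∉X u→m (arc⇒≢ m→w) (inj₂ (m , u→m , m→w)))

  beats-common-non-competitor : ∀ {u v z} → ¬ Competing12 D X → ¬ X z → X u → X v → C12 D u v →
                                ¬ C12 D u z → ¬ C12 D v z → Arc D u z
  beats-common-non-competitor ¬competing z∉X u∈X v∈X u~v u≁z v≁z with arc-between u∈X z∉X
  ... | inj₁ u→z = u→z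
  ... | inj₂ z→u = ⊥-elim (not-beaten ¬competing z∉X u∈X v∈X u~v u≁z v≁z z→u)

  -- u's witness for competing with t is z or lies behind z, and v → z lets v use it too;
  -- a path through v itself is rerouted through u.
  competitor-transfer : ∀ {u v z t} → X u → X v → Arc D v z → OutNbrs⊆ u z → u ≢ v →
                        C12 D u t → t ≢ v → C12 D v t
  competitor-transfer {u} {v} {z} {t} u∈X v∈X v→z u-out u≢v u~t t≢v = transfer (C12⇒prey u~t)
    where
      v≢t : v ≢ t
      v≢t = ≢-sym t≢v
      z≢v : z ≢ v
      z≢v = ≢-sym (arc⇒≢ v→z)
      reroute : Arc D u z → z ≢ t → Reach≤2 u t z → Reach≤2 v t z
      reroute _ z≢t (inj₁ t≡z) = ⊥-elim (z≢t (sym t≡z))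
      reroute _ _ (inj₂ (inj₁ t→z)) = inj₂ (inj₁ t→z)
      reroute u→z z≢t (inj₂ (inj₂ (y , _ , t→y , y→z))) with y ≟ v
      ... | no y≢v = inj₂ (inj₂ (y , y≢v , t→y , y→z))
      ... | yes refl with arc-between u∈X (λ t∈X → arc-leaves-X t∈X t→y v∈X)
      ...   | inj₁ u→t = ⊥-elim (z≢t (sym (u-out t u→t)))
      ...   | inj₂ t→u = inj₂ (inj₂ (u , u≢v , t→u , u→z))
      transfer : (∃ λ w → CommonPrey u t w ⊎ CommonPrey t u w) → C12 D v t
      transfer (w , inj₁ (_ , w≢t , u→w , t⇝w)) with u-out w u→w
      ... | refl = prey⇒C12 v≢t (z≢v , w≢t , v→z , reroute u→w w≢t t⇝w)
      transfer (w , inj₂ (_ , w≢u , _ , inj₁ u≡w)) = ⊥-elim (w≢u (sym u≡w))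
      transfer (w , inj₂ (w≢t , _ , t→w , inj₂ (inj₁ u→w))) with u-out w u→w
      ... | refl = prey⇒C12 v≢t (z≢v , w≢t , v→z , inj₂ (inj₁ t→w))
      transfer (w , inj₂ (w≢t , _ , t→w , inj₂ (inj₂ (m , m≢t , u→m , m→w)))) with u-out m u→m
      ... | refl = C12-sym (prey⇒C12 t≢v
                     (w≢t , (λ { refl → arc-asym v→z m→w }) , t→w ,
                      inj₂ (inj₂ (z , m≢t , v→z , m→w))))

  closed-nbhd⊆ : ∀ {u v z} → X u → X v → Arc D v z → OutNbrs⊆ u z → C12 D u v →
                 ∀ t → ClosedNbhd u t → ClosedNbhd v t
  closed-nbhd⊆ u∈X v∈X v→z u-out u~v t (inj₁ refl) = inj₂ (C12-sym u~v)
  closed-nbhd⊆ {v = v} u∈X v∈X v→z u-out u~v t (inj₂ u~t) with t ≟ v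
  ... | yes t≡v = inj₁ t≡v
  ... | no t≢v = inj₂ (competitor-transfer u∈X v∈X v→z u-out (proj₁ u~v) u~t t≢v)

lemma4p4 : ∀ {n k : ℕ} (D : Digraph n) (part : Fin n → Fin k) →
    IsMultipartiteTournament D k part →
    (i : Fin k) →
    ¬ Competing12 D (λ x → part x ≡ i) →
    (u v : Fin n) → part u ≡ i → part v ≡ i →
    C12 D u v → ¬ TrueTwins D u v →
    ∀ z → ¬ C12 D u z → ¬ C12 D v z → part z ≡ i
lemma4p4 D part mt i ¬competing u v u∈X v∈X u~v ¬twins z u≁z v≁z with part z ≟ i
... | yes z∈X = z∈X
... | no z∉X = ⊥-elim (¬twins λ t →
      mk⇔ (closed-nbhd⊆ u∈X v∈X v→z u-out u~v t) (closed-nbhd⊆ v∈X u∈X u→z v-out v~u t))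
  where
    open Competition D
    open PartiteSet mt i
    v~u : C12 D v u
    v~u = C12-sym u~v
    u→z : Arc D u z
    u→z = beats-common-non-competitor ¬competing z∉X u∈X v∈X u~v u≁z v≁z
    v→z : Arc D v z
    v→z = beats-common-non-competitor ¬competing z∉X v∈X u∈X v~u v≁z u≁z
    u-out : OutNbrs⊆ u z
    u-out = sole-out-neighbour ¬competing u≁z u∈X z∉X u→z
    v-out : OutNbrs⊆ v z
    v-out = sole-out-neighbour ¬competing v≁z v∈X z∉X v→z
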